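{- There exists an involution $\Phi$ on square lattice walks (words over $\{\mathsf N,\mathsf S,\mathsf E,\mathsf W\}$) that exchanges the number of $\mathsf{NW}$ and $\mathsf{WN}$ factors, fixes the number of $\mathsf{ES}$ and $\mathsf{SE}$ factors, and maps each shuffle class to itself. Consequently, in every shuffle class, the following bi-statistics of corners are equidistributed: $(\mathsf{NW},\mathsf{ES})$, $(\mathsf{WN},\mathsf{ES})$, $(\mathsf{WN},\mathsf{SE})$ and $(\mathsf{NW},\mathsf{SE})$.
   Context: Two words over $\{\mathsf N,\mathsf S,\mathsf E,\mathsf W\}$ are shuffle-equivalent if they have the same subword (projection) on $\{\mathsf N,\mathsf S\}$ and the same subword on $\{\mathsf E,\mathsf W\}$; a shuffle class is an equivalence class of this relation. An $XY$ factor is an occurrence of the letter $X$ immediately followed by the letter $Y$. A bi-statistic $(XY,ZT)$ assigns to a word the pair (number of $XY$ factors, number of $ZT$ factors). -}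

module Defs where

open import Data.Nat using (ℕ; zero; suc; _+_)
import Data.Nat as ℕ
open import Data.Bool using (Bool; true; false; _∧_; if_then_else_)
open import Data.List using (List; []; _∷_; length; filter; filterᵇ; map; concatMap)
import Data.List.Properties as LP
open import Data.Product using (_×_; _,_; proj₁; proj₂)
open import Relation.Binary.PropositionalEquality using (_≡_; refl)
open import Relation.Nullary using (Dec; yes; no)
open import Relation.Nullary.Decidable using (_×-dec_)

data Letter : Set where
  N S E W : Letter

Word : Set
Word = List Letter

_≟L_ : (x y : Letter) → Dec (x ≡ y)
N ≟L N = yes refl
N ≟L S = no (λ ())
N ≟L E = no (λ ())
N ≟L W = no (λ ())
S ≟L N = no (λ ())
S ≟L S = yes refl
S ≟L E = no (λ ())
S ≟L W = no (λ ())
E ≟L N = no (λ ())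
E ≟L S = no (λ ())
E ≟L E = yes refl
E ≟L W = no (λ ())
W ≟L N = no (λ ())
W ≟L S = no (λ ())
W ≟L E = no (λ ())
W ≟L W = yes refl

_==_ : Letter → Letter → Bool
N == N = true
S == S = true
E == E = true
W == W = true
_ == _ = false

_≟W_ : (u v : Word) → Dec (u ≡ v)
_≟W_ = LP.≡-dec _≟L_

isNS : Letter → Bool
isNS N = true
isNS S = true
isNS _ = false

isEW : Letter → Bool
isEW E = true
isEW W = true
isEW _ = false

projNS : Word → Word
projNS = filterᵇ isNS

projEW : Word → Word
projEW = filterᵇ isEW

_∼_ : Word → Word → Set
u ∼ v = (projNS u ≡ projNS v) × (projEW u ≡ projEW v)

_∼?_ : (u v : Word) → Dec (u ∼ v)
u ∼? v = (projNS u ≟W projNS v) ×-dec (projEW u ≟W projEW v)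

factors : Letter → Letter → Word → ℕ
factors X Y [] = 0
factors X Y (a ∷ []) = 0
factors X Y (a ∷ b ∷ w) = (if (a == X) ∧ (b == Y) then 1 else 0) + factors X Y (b ∷ w)

letters : List Letter
letters = N ∷ S ∷ E ∷ W ∷ []

wordsOfLength : ℕ → List Word
wordsOfLength zero = [] ∷ []
wordsOfLength (suc n) = concatMap (λ w → map (_∷ w) letters) (wordsOfLength n)

-- the shuffle class of w (shuffle-equivalent words have the same length)
shuffleClass : Word → List Word
shuffleClass w = filter (λ v → v ∼? w) (wordsOfLength (length w))

BiStat : Set
BiStat = Word → ℕ × ℕ

biStat : Letter → Letter → Letter → Letter → BiStat
biStat X Y Z T w = factors X Y w , factors Z T w

classCount : BiStat → Word → ℕ → ℕ → ℕ
classCount s w a b =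
  length (filter (λ v → (proj₁ (s v) ℕ.≟ a) ×-dec (proj₂ (s v) ℕ.≟ b)) (shuffleClass w))

EquidistributedOnClassOf : BiStat → BiStat → Word → Set
EquidistributedOnClassOf s t w = ∀ a b → classCount s w a b ≡ classCount t w a b

-- Φ reverses every maximal factor of a word made of the letters N and W.
-- These blocks are separated by S and E letters, so every NW or WN factor lies
-- inside a block, and reversing the block exchanges the two kinds.  A letter next
-- to an S or an E is either a separator, which stays in place, or a block letter,
-- which ES and SE do not distinguish; and the projections of a block on {N,S} and
-- on {E,W} are constant words, so the shuffle class is kept.  Reversing the blocks
-- of S and E letters instead gives an involution that fixes WN and exchanges ES
-- and SE.  An involution of a shuffle class that carries one bi-statistic onto
-- another shows that the two are equidistributed on it.
module Submission where

open import Defs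
open import Data.Product using (Σ; _×_)
open import Relation.Binary.PropositionalEquality using (_≡_)

open import Data.Bool using (Bool; true; false; _∧_; if_then_else_)
open import Data.Bool.Properties using (∧-comm)
open import Data.Empty using (⊥-elim)
open import Data.List
  using (List; []; _∷_; _++_; [_]; _∷ʳ_; _ʳ++_; reverse; length; map; filter; filterᵇ;
         concatMap; cartesianProductWith)
open import Data.List.Properties
  using (++-identityʳ; unfold-reverse; reverse-++; reverse-involutive; reverse-map;
         filter-++; map-++; length-map; ∷-injective)
open import Data.List.Membership.Propositional using (_∈_)
open import Data.List.Membership.Propositional.Properties
  using (∈-map⁺; ∈-map⁻; ∈-filter⁺; ∈-filter⁻; ∈-cartesianProductWith⁺)
open import Data.List.Membership.Propositional.Properties.WithK using (unique∧set⇒bag)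
open import Data.List.Relation.Binary.BagAndSetEquality using (_∼[_]_; bag; ∼bag⇒↭)
open import Data.List.Relation.Binary.Permutation.Propositional.Properties using (↭-length)
open import Data.List.Relation.Unary.All as All using (All; []; _∷_)
open import Data.List.Relation.Unary.AllPairs using ([]; _∷_)
import Data.List.Relation.Unary.All.Properties as AllP
import Data.List.Relation.Unary.Any.Properties as Any
open import Data.List.Relation.Unary.Any using (here; there)
open import Data.List.Relation.Unary.Unique.Propositional using (Unique)
import Data.List.Relation.Unary.Unique.Propositional.Properties as Unique
open import Data.Nat using (ℕ; zero; suc; _+_)
import Data.Nat as ℕ
open import Data.Nat.Properties using (+-comm; +-assoc; +-identityʳ; +-suc)
open import Data.Product using (_,_; proj₁; proj₂)
open import Function using (_∘_; flip)
open import Function.Bundles using (mk⇔)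
open import Relation.Binary.PropositionalEquality
  using (_≢_; ≢-sym; refl; sym; trans; cong; cong₂; subst; module ≡-Reasoning)
open import Relation.Nullary.Decidable using (_×-dec_)
open import Relation.Unary using (Decidable)

open ≡-Reasoning

≢⇒==false : ∀ {a b} → a ≢ b → (a == b) ≡ false
≢⇒==false {N} {N} a≢b = ⊥-elim (a≢b refl)
≢⇒==false {N} {S} _ = refl
≢⇒==false {N} {E} _ = refl
≢⇒==false {N} {W} _ = refl
≢⇒==false {S} {N} _ = refl
≢⇒==false {S} {S} a≢b = ⊥-elim (a≢b refl)
≢⇒==false {S} {E} _ = refl
≢⇒==false {S} {W} _ = refl
≢⇒==false {E} {N} _ = refl
≢⇒==false {E} {S} _ = refl
≢⇒==false {E} {E} a≢b = ⊥-elim (a≢b refl)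
≢⇒==false {E} {W} _ = refl
≢⇒==false {W} {N} _ = refl
≢⇒==false {W} {S} _ = refl
≢⇒==false {W} {E} _ = refl
≢⇒==false {W} {W} a≢b = ⊥-elim (a≢b refl)

module _ {A : Set} where

  All-reverse : ∀ {P : A → Set} {xs} → All P xs → All P (reverse xs)
  All-reverse ps = All.tabulate (All.lookup ps ∘ Any.reverse⁻)

  reverse-constant : ∀ {c : A} {xs} → All (_≡ c) xs → reverse xs ≡ xs
  reverse-constant [] = refl
  reverse-constant {c} {_ ∷ xs} (refl ∷ ps) = begin
    reverse (c ∷ xs)  ≡⟨ unfold-reverse c xs ⟩
    reverse xs ∷ʳ c   ≡⟨ cong (_∷ʳ c) (reverse-constant ps) ⟩
    xs ∷ʳ c           ≡⟨ ∷ʳ-constant ps ⟩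
    c ∷ xs            ∎
    where
    ∷ʳ-constant : ∀ {ys} → All (_≡ c) ys → ys ∷ʳ c ≡ c ∷ ys
    ∷ʳ-constant [] = refl
    ∷ʳ-constant (refl ∷ ps) = cong (c ∷_) (∷ʳ-constant ps)

  filterᵇ-reverse : ∀ (p : A → Bool) xs → filterᵇ p (reverse xs) ≡ reverse (filterᵇ p xs)
  filterᵇ-reverse p [] = refl
  filterᵇ-reverse p (x ∷ xs) = begin
    filterᵇ p (reverse (x ∷ xs))             ≡⟨ cong (filterᵇ p) (unfold-reverse x xs) ⟩
    filterᵇ p (reverse xs ++ [ x ])          ≡⟨ filter-++ _ (reverse xs) [ x ] ⟩
    filterᵇ p (reverse xs) ++ filterᵇ p [ x ] ≡⟨ cong (_++ filterᵇ p [ x ]) (filterᵇ-reverse p xs) ⟩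
    reverse (filterᵇ p xs) ++ filterᵇ p [ x ] ≡⟨ snoc-filtered ⟩
    reverse (filterᵇ p (x ∷ xs))             ∎
    where
    snoc-filtered : reverse (filterᵇ p xs) ++ filterᵇ p [ x ] ≡ reverse (filterᵇ p (x ∷ xs))
    snoc-filtered with p x
    ... | true  = sym (unfold-reverse x (filterᵇ p xs))
    ... | false = ++-identityʳ _

indicator : Bool → ℕ
indicator c = if c then 1 else 0

factors-++-∷ : ∀ X Y u a v → factors X Y (u ++ a ∷ v) ≡ factors X Y (u ∷ʳ a) + factors X Y (a ∷ v)
factors-++-∷ X Y [] a v = refl
factors-++-∷ X Y (b ∷ []) a v =
  cong (_+ factors X Y (a ∷ v)) (sym (+-identityʳ _))
factors-++-∷ X Y (b ∷ c ∷ u) a v =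
  trans (cong (indicator ((b == X) ∧ (c == Y)) +_) (factors-++-∷ X Y (c ∷ u) a v))
        (sym (+-assoc (indicator ((b == X) ∧ (c == Y))) _ _))

factors-reverse : ∀ X Y u → factors X Y (reverse u) ≡ factors Y X u
factors-reverse X Y [] = refl
factors-reverse X Y (a ∷ []) = refl
factors-reverse X Y (a ∷ b ∷ u) = begin
  factors X Y (reverse (a ∷ b ∷ u))
    ≡⟨ cong (factors X Y) (reverse-++ (a ∷ b ∷ []) u) ⟩
  factors X Y (reverse u ++ b ∷ a ∷ [])
    ≡⟨ factors-++-∷ X Y (reverse u) b (a ∷ []) ⟩
  factors X Y (reverse u ∷ʳ b) + factors X Y (b ∷ a ∷ [])
    ≡⟨ cong₂ _+_ (cong (factors X Y) (sym (unfold-reverse b u))) (+-identityʳ _) ⟩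
  factors X Y (reverse (b ∷ u)) + indicator ((b == X) ∧ (a == Y))
    ≡⟨ cong₂ _+_ (factors-reverse X Y (b ∷ u)) (cong indicator (∧-comm (b == X) (a == Y))) ⟩
  factors Y X (b ∷ u) + indicator ((a == Y) ∧ (b == X))
    ≡⟨ +-comm (factors Y X (b ∷ u)) _ ⟩
  factors Y X (a ∷ b ∷ u) ∎

factors-∷ : ∀ X Y {a} v → a ≢ X → factors X Y (a ∷ v) ≡ factors X Y v
factors-∷ X Y [] a≢X = refl
factors-∷ X Y (b ∷ v) a≢X rewrite ≢⇒==false a≢X = refl

factors-∷ʳ : ∀ X Y u {a} → a ≢ Y → factors X Y (u ∷ʳ a) ≡ factors X Y u
factors-∷ʳ X Y u {a} a≢Y = begin
  factors X Y (u ∷ʳ a)             ≡⟨ sym (factors-reverse Y X (u ∷ʳ a)) ⟩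
  factors Y X (reverse (u ∷ʳ a))   ≡⟨ cong (factors Y X) (reverse-++ u [ a ]) ⟩
  factors Y X (a ∷ reverse u)      ≡⟨ factors-∷ Y X (reverse u) a≢Y ⟩
  factors Y X (reverse u)          ≡⟨ factors-reverse Y X u ⟩
  factors X Y u                    ∎

factors-++-separator : ∀ X Y u {x} v → x ≢ X → x ≢ Y →
                       factors X Y (u ++ x ∷ v) ≡ factors X Y u + factors X Y v
factors-++-separator X Y u {x} v x≢X x≢Y = begin
  factors X Y (u ++ x ∷ v)
    ≡⟨ factors-++-∷ X Y u x v ⟩
  factors X Y (u ∷ʳ x) + factors X Y (x ∷ v)
    ≡⟨ cong₂ _+_ (factors-∷ʳ X Y u x≢Y) (factors-∷ X Y v x≢X) ⟩
  factors X Y u + factors X Y v ∎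

factors-map : ∀ X Y (g : Letter → Letter) →
              (∀ a → (g a == X) ≡ (a == X)) → (∀ a → (g a == Y) ≡ (a == Y)) →
              ∀ w → factors X Y (map g w) ≡ factors X Y w
factors-map X Y g gX gY [] = refl
factors-map X Y g gX gY (a ∷ []) = refl
factors-map X Y g gX gY (a ∷ b ∷ w) =
  cong₂ (λ c n → indicator c + n) (cong₂ _∧_ (gX a) (gY b)) (factors-map X Y g gX gY (b ∷ w))

module BlockReversal (inBlock : Letter → Bool) where

  Block : Word → Set
  Block = All (λ a → inBlock a ≡ true)

  block≢separator : ∀ {a x} → inBlock a ≡ true → inBlock x ≡ false → a ≢ x
  block≢separator a∈ x∉ refl with () ← trans (sym a∈) x∉

  -- The accumulator holds the part of the current block read so far, reversed.
  reverseBlocksFrom : Word → Word → Word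
  reverseBlocksFrom acc [] = acc
  reverseBlocksFrom acc (a ∷ w) with inBlock a
  ... | true  = reverseBlocksFrom (a ∷ acc) w
  ... | false = acc ++ a ∷ reverseBlocksFrom [] w

  reverseBlocks : Word → Word
  reverseBlocks = reverseBlocksFrom []

  reverseBlocksFrom-++ : ∀ acc {u} → Block u → ∀ v →
                         reverseBlocksFrom acc (u ++ v) ≡ reverseBlocksFrom (u ʳ++ acc) v
  reverseBlocksFrom-++ acc [] v = refl
  reverseBlocksFrom-++ acc {a ∷ u} (a∈ ∷ u∈) v rewrite a∈ = reverseBlocksFrom-++ (a ∷ acc) u∈ v

  reverseBlocks-block : ∀ {u} → Block u → reverseBlocks u ≡ reverse u
  reverseBlocks-block {u} u∈ = begin
    reverseBlocks u          ≡⟨ cong reverseBlocks (sym (++-identityʳ u)) ⟩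
    reverseBlocks (u ++ [])  ≡⟨ reverseBlocksFrom-++ [] u∈ [] ⟩
    reverse u                ∎

  reverseBlocks-separator : ∀ {u x} w → Block u → inBlock x ≡ false →
                            reverseBlocks (u ++ x ∷ w) ≡ reverse u ++ x ∷ reverseBlocks w
  reverseBlocks-separator {x = x} w u∈ x∉ rewrite reverseBlocksFrom-++ [] u∈ (x ∷ w) | x∉ = refl

  data Blocks : Word → Set where
    lastBlock : ∀ {u} → Block u → Blocks u
    _⟨_⟩_     : ∀ {u x w} → Block u → inBlock x ≡ false → Blocks w → Blocks (u ++ x ∷ w)

  _∷ᵇ_ : ∀ {a w} → inBlock a ≡ true → Blocks w → Blocks (a ∷ w)
  a∈ ∷ᵇ lastBlock u∈ = lastBlock (a∈ ∷ u∈)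
  a∈ ∷ᵇ (u∈ ⟨ x∉ ⟩ bs) = (a∈ ∷ u∈) ⟨ x∉ ⟩ bs

  blocks : ∀ w → Blocks w
  blocks [] = lastBlock []
  blocks (a ∷ w) with inBlock a in a∈?
  ... | true  = a∈? ∷ᵇ blocks w
  ... | false = [] ⟨ a∈? ⟩ blocks w

  reverseBlocks-involutive : ∀ w → reverseBlocks (reverseBlocks w) ≡ w
  reverseBlocks-involutive w = involutive (blocks w)
    where
    involutive : ∀ {w} → Blocks w → reverseBlocks (reverseBlocks w) ≡ w
    involutive (lastBlock {u} u∈) = begin
      reverseBlocks (reverseBlocks u)  ≡⟨ cong reverseBlocks (reverseBlocks-block u∈) ⟩
      reverseBlocks (reverse u)        ≡⟨ reverseBlocks-block (All-reverse u∈) ⟩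
      reverse (reverse u)              ≡⟨ reverse-involutive u ⟩
      u                                ∎
    involutive (_⟨_⟩_ {u} {x} {w} u∈ x∉ bs) = begin
      reverseBlocks (reverseBlocks (u ++ x ∷ w))
        ≡⟨ cong reverseBlocks (reverseBlocks-separator w u∈ x∉) ⟩
      reverseBlocks (reverse u ++ x ∷ reverseBlocks w)
        ≡⟨ reverseBlocks-separator (reverseBlocks w) (All-reverse u∈) x∉ ⟩
      reverse (reverse u) ++ x ∷ reverseBlocks (reverseBlocks w)
        ≡⟨ cong₂ (λ u′ w′ → u′ ++ x ∷ w′) (reverse-involutive u) (involutive bs) ⟩
      u ++ x ∷ w ∎

  reverseBlocks-preserves : ∀ {A : Set} (f : Word → List A) →
                            (∀ u v → f (u ++ v) ≡ f u ++ f v) →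
                            (∀ {u} → Block u → f (reverse u) ≡ f u) →
                            ∀ w → f (reverseBlocks w) ≡ f w
  reverseBlocks-preserves f f-++ f-reverse w = preserves (blocks w)
    where
    preserves : ∀ {w} → Blocks w → f (reverseBlocks w) ≡ f w
    preserves (lastBlock {u} u∈) = trans (cong f (reverseBlocks-block u∈)) (f-reverse u∈)
    preserves (_⟨_⟩_ {u} {x} {w} u∈ x∉ bs) = begin
      f (reverseBlocks (u ++ x ∷ w))            ≡⟨ cong f (reverseBlocks-separator w u∈ x∉) ⟩
      f (reverse u ++ x ∷ reverseBlocks w)      ≡⟨ f-++ (reverse u) _ ⟩
      f (reverse u) ++ f (x ∷ reverseBlocks w)  ≡⟨ cong₂ _++_ (f-reverse u∈) (f-++ [ x ] _) ⟩
      f u ++ f [ x ] ++ f (reverseBlocks w)     ≡⟨ cong (λ z → f u ++ f [ x ] ++ z) (preserves bs) ⟩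
      f u ++ f [ x ] ++ f w                     ≡⟨ cong (f u ++_) (sym (f-++ [ x ] w)) ⟩
      f u ++ f (x ∷ w)                          ≡⟨ sym (f-++ u (x ∷ w)) ⟩
      f (u ++ x ∷ w)                            ∎

  filterᵇ-block : ∀ (p : Letter → Bool) {c} → (∀ a → inBlock a ≡ true → p a ≡ true → a ≡ c) →
                  ∀ {u} → Block u → All (_≡ c) (filterᵇ p u)
  filterᵇ-block p only-c [] = []
  filterᵇ-block p only-c {a ∷ u} (a∈ ∷ u∈) with p a in pa
  ... | true  = only-c a a∈ pa ∷ filterᵇ-block p only-c u∈
  ... | false = filterᵇ-block p only-c u∈

  reverseBlocks-∼ : ∀ {n e} →
                    (∀ a → inBlock a ≡ true → isNS a ≡ true → a ≡ n) →
                    (∀ a → inBlock a ≡ true → isEW a ≡ true → a ≡ e) →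
                    ∀ w → reverseBlocks w ∼ w
  reverseBlocks-∼ only-n only-e w =
    reverseBlocks-preserves projNS (filter-++ _) (projection-reverse isNS only-n) w ,
    reverseBlocks-preserves projEW (filter-++ _) (projection-reverse isEW only-e) w
    where
    projection-reverse : ∀ p {c} → (∀ a → inBlock a ≡ true → p a ≡ true → a ≡ c) →
                         ∀ {u} → Block u → filterᵇ p (reverse u) ≡ filterᵇ p u
    projection-reverse p only-c {u} u∈ =
      trans (filterᵇ-reverse p u) (reverse-constant (filterᵇ-block p only-c u∈))

  factors-reverseBlocks-inside : ∀ {X Y} → inBlock X ≡ true → inBlock Y ≡ true →
                                 ∀ w → factors X Y (reverseBlocks w) ≡ factors Y X w
  factors-reverseBlocks-inside {X} {Y} X∈ Y∈ w = swaps (blocks w)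
    where
    swaps : ∀ {w} → Blocks w → factors X Y (reverseBlocks w) ≡ factors Y X w
    swaps (lastBlock {u} u∈) =
      trans (cong (factors X Y) (reverseBlocks-block u∈)) (factors-reverse X Y u)
    swaps (_⟨_⟩_ {u} {x} {w} u∈ x∉ bs) = begin
      factors X Y (reverseBlocks (u ++ x ∷ w))
        ≡⟨ cong (factors X Y) (reverseBlocks-separator w u∈ x∉) ⟩
      factors X Y (reverse u ++ x ∷ reverseBlocks w)
        ≡⟨ factors-++-separator X Y (reverse u) (reverseBlocks w) x≢X x≢Y ⟩
      factors X Y (reverse u) + factors X Y (reverseBlocks w)
        ≡⟨ cong₂ _+_ (factors-reverse X Y u) (swaps bs) ⟩
      factors Y X u + factors Y X w
        ≡⟨ sym (factors-++-separator Y X u w x≢Y x≢X) ⟩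
      factors Y X (u ++ x ∷ w) ∎
      where
      x≢X = ≢-sym (block≢separator X∈ x∉)
      x≢Y = ≢-sym (block≢separator Y∈ x∉)

  -- Collapsing all block letters to one block letter b makes every block constant,
  -- and factors of two non-block letters do not see the collapse.
  factors-reverseBlocks-outside : ∀ {b X Y} → inBlock b ≡ true →
                                  inBlock X ≡ false → inBlock Y ≡ false →
                                  ∀ w → factors X Y (reverseBlocks w) ≡ factors X Y w
  factors-reverseBlocks-outside {b} {X} {Y} b∈ X∉ Y∉ w = begin
    factors X Y (reverseBlocks w)                 ≡⟨ sym (collapse-factors (reverseBlocks w)) ⟩
    factors X Y (map collapse (reverseBlocks w))  ≡⟨ cong (factors X Y) collapse-reverseBlocks ⟩
    factors X Y (map collapse w)                  ≡⟨ collapse-factors w ⟩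
    factors X Y w                                 ∎
    where
    collapse : Letter → Letter
    collapse a = if inBlock a then b else a

    collapse-block : ∀ {a} → inBlock a ≡ true → collapse a ≡ b
    collapse-block a∈ rewrite a∈ = refl

    collapse-== : ∀ {Z} → inBlock Z ≡ false → ∀ a → (collapse a == Z) ≡ (a == Z)
    collapse-== Z∉ a with inBlock a in a∈
    ... | true  = trans (≢⇒==false (block≢separator b∈ Z∉))
                        (sym (≢⇒==false (block≢separator a∈ Z∉)))
    ... | false = refl

    collapse-factors : ∀ w → factors X Y (map collapse w) ≡ factors X Y w
    collapse-factors = factors-map X Y collapse (collapse-== X∉) (collapse-== Y∉)

    collapse-reverse : ∀ {u} → Block u → map collapse (reverse u) ≡ map collapse u
    collapse-reverse {u} u∈ = trans (reverse-map collapse u)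
      (reverse-constant (AllP.map⁺ (All.map collapse-block u∈)))

    collapse-reverseBlocks : map collapse (reverseBlocks w) ≡ map collapse w
    collapse-reverseBlocks =
      reverseBlocks-preserves (map collapse) (map-++ collapse) collapse-reverse w

wordsOfLength-suc : ∀ n →
                    wordsOfLength (suc n) ≡ cartesianProductWith (flip _∷_) (wordsOfLength n) letters
wordsOfLength-suc n = concatMap≡cartesianProductWith (wordsOfLength n)
  where
  concatMap≡cartesianProductWith : ∀ ws → concatMap (λ w → map (_∷ w) letters) ws
                                         ≡ cartesianProductWith (flip _∷_) ws letters
  concatMap≡cartesianProductWith [] = refl
  concatMap≡cartesianProductWith (w ∷ ws) =
    cong (map (_∷ w) letters ++_) (concatMap≡cartesianProductWith ws)

letters-unique : Unique letters
letters-unique = ((λ ()) ∷ (λ ()) ∷ (λ ()) ∷ []) ∷ ((λ ()) ∷ (λ ()) ∷ []) ∷ ((λ ()) ∷ []) ∷ [] ∷ []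

letters-complete : ∀ a → a ∈ letters
letters-complete N = here refl
letters-complete S = there (here refl)
letters-complete E = there (there (here refl))
letters-complete W = there (there (there (here refl)))

wordsOfLength-unique : ∀ n → Unique (wordsOfLength n)
wordsOfLength-unique zero = [] ∷ []
wordsOfLength-unique (suc n) rewrite wordsOfLength-suc n =
  Unique.cartesianProductWith⁺ (flip _∷_) (λ eq → proj₂ (∷-injective eq) , proj₁ (∷-injective eq))
    (wordsOfLength-unique n) letters-unique

wordsOfLength-complete : ∀ w → w ∈ wordsOfLength (length w)
wordsOfLength-complete [] = here refl
wordsOfLength-complete (a ∷ w) rewrite wordsOfLength-suc (length w) =
  ∈-cartesianProductWith⁺ (flip _∷_) (wordsOfLength-complete w) (letters-complete a)

length-projNS+projEW : ∀ w → length w ≡ length (projNS w) + length (projEW w)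
length-projNS+projEW [] = refl
length-projNS+projEW (N ∷ w) = cong suc (length-projNS+projEW w)
length-projNS+projEW (S ∷ w) = cong suc (length-projNS+projEW w)
length-projNS+projEW (E ∷ w) = trans (cong suc (length-projNS+projEW w)) (sym (+-suc _ _))
length-projNS+projEW (W ∷ w) = trans (cong suc (length-projNS+projEW w)) (sym (+-suc _ _))

∼-length : ∀ {u v} → u ∼ v → length u ≡ length v
∼-length {u} {v} (ns , ew) = begin
  length u                                   ≡⟨ length-projNS+projEW u ⟩
  length (projNS u) + length (projEW u)      ≡⟨ cong₂ (λ p q → length p + length q) ns ew ⟩
  length (projNS v) + length (projEW v)      ≡⟨ sym (length-projNS+projEW v) ⟩
  length v                                   ∎

∼-trans : ∀ {u v w} → u ∼ v → v ∼ w → u ∼ w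
∼-trans (ns , ew) (ns′ , ew′) = trans ns ns′ , trans ew ew′

shuffleClass-unique : ∀ w → Unique (shuffleClass w)
shuffleClass-unique w = Unique.filter⁺ (_∼? w) (wordsOfLength-unique (length w))

∈-shuffleClass⁺ : ∀ {v w} → v ∼ w → v ∈ shuffleClass w
∈-shuffleClass⁺ {v} {w} v∼w = ∈-filter⁺ (_∼? w)
  (subst (λ n → v ∈ wordsOfLength n) (∼-length {v} {w} v∼w) (wordsOfLength-complete v)) v∼w

∈-shuffleClass⁻ : ∀ {v w} → v ∈ shuffleClass w → v ∼ w
∈-shuffleClass⁻ {w = w} = proj₂ ∘ ∈-filter⁻ (_∼? w) {xs = wordsOfLength (length w)}

length-filter-involution :
  ∀ {A : Set} (F : A → A) → (∀ x → F (F x) ≡ x) →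
  ∀ {xs} → Unique xs → (∀ {x} → x ∈ xs → F x ∈ xs) →
  ∀ {P Q : A → Set} (P? : Decidable P) (Q? : Decidable Q) →
  (∀ {x} → P x → Q (F x)) → (∀ {x} → Q x → P (F x)) →
  length (filter P? xs) ≡ length (filter Q? xs)
length-filter-involution F F-inv {xs} xs! F-closed P? Q? P⇒QF Q⇒PF = begin
  length (filter P? xs)          ≡⟨ sym (length-map F (filter P? xs)) ⟩
  length (map F (filter P? xs))  ≡⟨ ↭-length (∼bag⇒↭ image∼filter) ⟩
  length (filter Q? xs)          ∎
  where
  F-injective : ∀ {x y} → F x ≡ F y → x ≡ y
  F-injective {x} {y} eq = trans (sym (F-inv x)) (trans (cong F eq) (F-inv y))

  image! : Unique (map F (filter P? xs))
  image! = Unique.map⁺ F-injective (Unique.filter⁺ P? xs!)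

  to : ∀ {x} → x ∈ map F (filter P? xs) → x ∈ filter Q? xs
  to x∈ with ∈-map⁻ F x∈
  ... | y , y∈ , refl with ∈-filter⁻ P? y∈
  ... | y∈xs , Py = ∈-filter⁺ Q? (F-closed y∈xs) (P⇒QF Py)

  from : ∀ {x} → x ∈ filter Q? xs → x ∈ map F (filter P? xs)
  from {x} x∈ with ∈-filter⁻ Q? x∈
  ... | x∈xs , Qx = subst (_∈ map F (filter P? xs)) (F-inv x)
                      (∈-map⁺ F (∈-filter⁺ P? (F-closed x∈xs) (Q⇒PF Qx)))

  image∼filter : map F (filter P? xs) ∼[ bag ] filter Q? xs
  image∼filter = unique∧set⇒bag image! (Unique.filter⁺ Q? xs!) (mk⇔ to from)

equidistributed-by-involution :
  (F : Word → Word) → (∀ w → F (F w) ≡ w) → (∀ w → F w ∼ w) →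
  (s t : BiStat) → (∀ w → t (F w) ≡ s w) → ∀ w → EquidistributedOnClassOf s t w
equidistributed-by-involution F F-inv F-∼ s t t∘F≡s w a b =
  length-filter-involution F F-inv (shuffleClass-unique w) F-closed (takes s) (takes t)
    (λ {v} (p , q) → trans (cong proj₁ (t∘F≡s v)) p , trans (cong proj₂ (t∘F≡s v)) q)
    (λ {v} (p , q) → trans (cong proj₁ (s∘F≡t v)) p , trans (cong proj₂ (s∘F≡t v)) q)
  where
  takes : (r : BiStat) → Decidable (λ v → (proj₁ (r v) ≡ a) × (proj₂ (r v) ≡ b))
  takes r v = (proj₁ (r v) ℕ.≟ a) ×-dec (proj₂ (r v) ℕ.≟ b)

  s∘F≡t : ∀ v → s (F v) ≡ t v
  s∘F≡t v = trans (sym (t∘F≡s (F v))) (cong t (F-inv v))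

  F-closed : ∀ {v} → v ∈ shuffleClass w → F v ∈ shuffleClass w
  F-closed {v} v∈ =
    ∈-shuffleClass⁺ {F v} {w} (∼-trans {F v} {v} {w} (F-∼ v) (∈-shuffleClass⁻ {v} {w} v∈))

isNW : Letter → Bool
isNW N = true
isNW W = true
isNW _ = false

isSE : Letter → Bool
isSE S = true
isSE E = true
isSE _ = false

module NW = BlockReversal isNW
module SE = BlockReversal isSE

Φ : Word → Word
Φ = NW.reverseBlocks

Ψ : Word → Word
Ψ = SE.reverseBlocks

Φ-∼ : ∀ w → Φ w ∼ w
Φ-∼ = NW.reverseBlocks-∼ (λ { N _ _ → refl ; W _ () }) (λ { N _ () ; W _ _ → refl })

Φ-NW : ∀ w → factors N W (Φ w) ≡ factors W N w
Φ-NW = NW.factors-reverseBlocks-inside refl refl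

Φ-WN : ∀ w → factors W N (Φ w) ≡ factors N W w
Φ-WN = NW.factors-reverseBlocks-inside refl refl

Φ-ES : ∀ w → factors E S (Φ w) ≡ factors E S w
Φ-ES = NW.factors-reverseBlocks-outside {N} refl refl refl

Φ-SE : ∀ w → factors S E (Φ w) ≡ factors S E w
Φ-SE = NW.factors-reverseBlocks-outside {N} refl refl refl

Ψ-∼ : ∀ w → Ψ w ∼ w
Ψ-∼ = SE.reverseBlocks-∼ (λ { S _ _ → refl ; E _ () }) (λ { S _ () ; E _ _ → refl })

Ψ-WN : ∀ w → factors W N (Ψ w) ≡ factors W N w
Ψ-WN = SE.factors-reverseBlocks-outside {S} refl refl refl

Ψ-SE : ∀ w → factors S E (Ψ w) ≡ factors E S w
Ψ-SE = SE.factors-reverseBlocks-inside refl refl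

proposition4p5 : Σ (Word → Word) (λ Φ →
    (∀ w → Φ (Φ w) ≡ w)
    × (∀ w → factors N W (Φ w) ≡ factors W N w)
    × (∀ w → factors W N (Φ w) ≡ factors N W w)
    × (∀ w → factors E S (Φ w) ≡ factors E S w)
    × (∀ w → factors S E (Φ w) ≡ factors S E w)
    × (∀ w → Φ w ∼ w))
    × (∀ w → EquidistributedOnClassOf (biStat N W E S) (biStat W N E S) w
    × EquidistributedOnClassOf (biStat W N E S) (biStat W N S E) w
    × EquidistributedOnClassOf (biStat W N S E) (biStat N W S E) w)
proposition4p5 =
  (Φ , NW.reverseBlocks-involutive , Φ-NW , Φ-WN , Φ-ES , Φ-SE , Φ-∼) ,
  λ w →
    equidistributed-by-involution Φ NW.reverseBlocks-involutive Φ-∼ _ _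
      (λ v → cong₂ _,_ (Φ-WN v) (Φ-ES v)) w ,
    equidistributed-by-involution Ψ SE.reverseBlocks-involutive Ψ-∼ _ _
      (λ v → cong₂ _,_ (Ψ-WN v) (Ψ-SE v)) w ,
    equidistributed-by-involution Φ NW.reverseBlocks-involutive Φ-∼ _ _
      (λ v → cong₂ _,_ (Φ-NW v) (Φ-SE v)) w
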